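{- Let $(\mathcal F,\mathcal R)$ be an AFSM with $\mathcal F$ at most countably infinite, and let $\mathcal F_{\mathcal R}\subseteq\mathcal F$ be the set of function symbols occurring in some rule of $\mathcal R$. Then $\to_{\mathcal R}$ is terminating on $\mathcal T(\mathcal F,\mathcal V)$ if and only if $\to_{\mathcal R}$ is terminating on $\mathcal T(\mathcal F_{\mathcal R},\mathcal V)$.
   Context: Fix a set $\mathcal S$ of sorts. Types: every sort is a type, and $\sigma\to\tau$ is a type for types $\sigma,\tau$ ($\to$ right-associative); every type is uniquely $\sigma_1\to\cdots\to\sigma_m\to\iota$ with $\iota\in\mathcal S$. Fix pairwise disjoint sets $\mathcal F$ (function symbols), $\mathcal V$ (variables), $\mathcal M$ (meta-variables), each symbol with a type; each meta-variable $Z$ also has a natural number $\mathit{arity}(Z)$; $\mathcal V$ and $\mathcal M$ contain infinitely many symbols of every type. Meta-terms are the expressions typable by: $x:\sigma$ if $x:\sigma\in\mathcal V$; $\mathsf f:\sigma$ if $\mathsf f:\sigma\in\mathcal F$; $s\,t:\tau$ if $s:\sigma\to\tau$, $t:\sigma$; $\lambda x.s:\sigma\to\tau$ if $x:\sigma\in\mathcal V$, $s:\tau$; $Z\langle s_1,\dots,s_k\rangle:\sigma_{k+1}\to\cdots\to\sigma_m\to\iota$ if $Z$ has type $\sigma_1\to\cdots\to\sigma_m\to\iota$ and arity $k$ and $s_i:\sigma_i$ (write $Z$ for $Z\langle\rangle$). Terms are meta-terms without meta-variables; $\mathcal T(\mathcal F,\mathcal V)$ is the set of terms over $\mathcal F,\mathcal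 V$. Application is left-associative, $\lambda$ binds variables, everything is modulo $\alpha$-conversion; $FV(s)$, $FMV(s)$ are the free variables and the meta-variables of $s$; $s$ is closed if $FV(s)=\emptyset$. A pattern is a meta-term of the form $Z\langle x_1,\dots,x_k\rangle$ with distinct variables $x_i$, or $\lambda x.\ell$ with $\ell$ a pattern, or $a\,\ell_1\cdots\ell_n$ with $a\in\mathcal F\cup\mathcal V$, $n\ge0$ and all $\ell_i$ patterns. A meta-substitution $\gamma$ is a type-preserving map from variables and meta-variables to meta-terms; its domain consists of the variables $x$ with $\gamma(x)\neq x$ and the meta-variables $Z$ of arity $k$ with $\gamma(Z)\neq\lambda y_1\dots y_k.Z\langle y_1,\dots,y_k\rangle$; a substitution maps its domain to terms. Application: $x\gamma=\gamma(x)$, $\mathsf f\gamma=\mathsf f$, $(s\,t)\gamma=(s\gamma)(t\gamma)$, $(\lambda x.s)\gamma=\lambda x.(s\gamma)$ (with $x$ chosen fresh), $Z\langle s_1,..,s_k\rangle\gamma=Z\langle s_1\gamma,..,s_k\gamma\rangle$ if $Z\notin\mathrm{dom}(\gamma)$, and otherwise, writing $\gamma(Z)=\lambda x_1\dots x_n.u$ with $n=k$, or $n<k$ and $u$ not an abstraction, $Z\langle s_1,..,s_k\rangle\gamma=u[x_1:=s_1\gamma,..,x_n:=s_n\gamma]\,(s_{n+1}\gamma)\cdots(s_k\gamma)$. A rule is a pair $\ell\Rightarrow r$ of closed meta-terms of the same type with $\ell$ a pattern of the form $\mathsf f\,\ell_1\cdots\ell_n$, $\mathsf f\in\mathcal F$,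 and $FMV(r)\subseteq FMV(\ell)$. For a (possibly infinite) set of rules $\mathcal R$, $\to_{\mathcal R}$ is the smallest relation on terms closed under application contexts on both sides and under $\lambda$, containing $\ell\delta\to_{\mathcal R}r\delta$ for $\ell\Rightarrow r\in\mathcal R$ and substitutions $\delta$ with $\mathrm{dom}(\delta)=FMV(\ell)$, and $(\lambda x.s)\,t\to_{\mathcal R}s[x:=t]$. $\to_{\mathcal R}$ is terminating on a set of terms if there is no infinite $\to_{\mathcal R}$-reduction starting from one of them. An AFSM is a pair $(\mathcal F,\mathcal R)$ of a signature and a set of rules over it. -}

module Defs where

open import Data.Nat using (ℕ; zero; suc)
open import Data.Fin using (Fin)
open import Data.List using (List; []; _∷_; _++_; length)
open import Data.List.Relation.Unary.Unique.Propositional using (Unique)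
open import Data.Product using (Σ; _×_; _,_)
open import Data.Sum using (_⊎_)
open import Data.Unit using (⊤)
open import Data.Maybe using (Maybe; just; nothing)
open import Relation.Binary.PropositionalEquality using (_≡_; refl)
open import Relation.Nullary using (¬_)

infix 4 _∋_
data _∋_ {A : Set} : List A → A → Set where
  here  : ∀ {x xs} → (x ∷ xs) ∋ x
  there : ∀ {x y xs} → xs ∋ x → (y ∷ xs) ∋ x

position : ∀ {A : Set} {xs : List A} {x} → xs ∋ x → Fin (length xs)
position here      = Fin.zero
position (there p) = Fin.suc (position p)

infixr 7 _⇒_
data Ty (S : Set) : Set where
  base : S → Ty S
  _⇒_  : Ty S → Ty S → Ty S

_⇒*_ : ∀ {S} → List (Ty S) → Ty S → Ty S
[]       ⇒* τ = τ
(a ∷ as) ⇒* τ = a ⇒ (as ⇒* τ)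

-- Variables are de Bruijn indices into a
-- typed context Γ (so terms are modulo α-conversion, and there are
-- infinitely many variables of each type).  A meta-variable of type
-- a₁ → ⋯ → aₖ → τ and arity k is a position in a meta-context Δ holding
-- the entry (a₁ ∷ ⋯ ∷ aₖ ∷ [] , τ).

module _ {S : Set} {F : Set} (ty : F → Ty S) where

  MCtx : Set
  MCtx = List (List (Ty S) × Ty S)

  mutual
    data MTerm (Δ : MCtx) (Γ : List (Ty S)) : Ty S → Set where
      var  : ∀ {σ} → Γ ∋ σ → MTerm Δ Γ σ
      fun  : (f : F) → MTerm Δ Γ (ty f)
      app  : ∀ {σ τ} → MTerm Δ Γ (σ ⇒ τ) → MTerm Δ Γ σ → MTerm Δ Γ τ
      lam  : ∀ {σ τ} → MTerm Δ (σ ∷ Γ) τ → MTerm Δ Γ (σ ⇒ τ)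
      meta : ∀ {as τ} → Δ ∋ (as , τ) → MArgs Δ Γ as → MTerm Δ Γ τ

    data MArgs (Δ : MCtx) (Γ : List (Ty S)) : List (Ty S) → Set where
      []  : MArgs Δ Γ []
      _∷_ : ∀ {a as} → MTerm Δ Γ a → MArgs Δ Γ as → MArgs Δ Γ (a ∷ as)

  Term : List (Ty S) → Ty S → Set
  Term = MTerm []

  Ren : List (Ty S) → List (Ty S) → Set
  Ren Γ Γ' = ∀ {a} → Γ ∋ a → Γ' ∋ a

  extR : ∀ {Γ Γ' a} → Ren Γ Γ' → Ren (a ∷ Γ) (a ∷ Γ')
  extR ρ here      = here
  extR ρ (there x) = there (ρ x)

  mutual
    ren : ∀ {Δ Γ Γ' σ} → Ren Γ Γ' → MTerm Δ Γ σ → MTerm Δ Γ' σ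
    ren ρ (var x)     = var (ρ x)
    ren ρ (fun f)     = fun f
    ren ρ (app s t)   = app (ren ρ s) (ren ρ t)
    ren ρ (lam s)     = lam (ren (extR ρ) s)
    ren ρ (meta Z ss) = meta Z (renArgs ρ ss)

    renArgs : ∀ {Δ Γ Γ' as} → Ren Γ Γ' → MArgs Δ Γ as → MArgs Δ Γ' as
    renArgs ρ []       = []
    renArgs ρ (s ∷ ss) = ren ρ s ∷ renArgs ρ ss

  Sub : MCtx → List (Ty S) → List (Ty S) → Set
  Sub Δ Γ Γ' = ∀ {a} → Γ ∋ a → MTerm Δ Γ' a

  _∷ₛ_ : ∀ {Δ Γ Γ' a} → MTerm Δ Γ' a → Sub Δ Γ Γ' → Sub Δ (a ∷ Γ) Γ'
  (t ∷ₛ σ) here      = t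
  (t ∷ₛ σ) (there x) = σ x

  extS : ∀ {Δ Γ Γ' a} → Sub Δ Γ Γ' → Sub Δ (a ∷ Γ) (a ∷ Γ')
  extS σ here      = var here
  extS σ (there x) = ren there (σ x)

  mutual
    sub : ∀ {Δ Γ Γ' τ} → Sub Δ Γ Γ' → MTerm Δ Γ τ → MTerm Δ Γ' τ
    sub σ (var x)     = σ x
    sub σ (fun f)     = fun f
    sub σ (app s t)   = app (sub σ s) (sub σ t)
    sub σ (lam s)     = lam (sub (extS σ) s)
    sub σ (meta Z ss) = meta Z (subArgs σ ss)

    subArgs : ∀ {Δ Γ Γ' as} → Sub Δ Γ Γ' → MArgs Δ Γ as → MArgs Δ Γ' as
    subArgs σ []       = []
    subArgs σ (s ∷ ss) = sub σ s ∷ subArgs σ ss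

  _[_] : ∀ {Δ Γ a τ} → MTerm Δ (a ∷ Γ) τ → MTerm Δ Γ a → MTerm Δ Γ τ
  s [ t ] = sub (t ∷ₛ var) s

  apply* : ∀ {Γ as τ} → Term Γ (as ⇒* τ) → MArgs [] Γ as → Term Γ τ
  apply* t []       = t
  apply* t (s ∷ ss) = apply* (app t s) ss

  body?′ : ∀ {Γ ρ} → Term Γ ρ → ∀ a b → ρ ≡ (a ⇒ b) → Maybe (Term (a ∷ Γ) b)
  body?′ (lam t) a b refl = just t
  body?′ _       _ _ _    = nothing

  body? : ∀ {Γ a b} → Term Γ (a ⇒ b) → Maybe (Term (a ∷ Γ) b)
  body? {a = a} {b} t = body?′ t a b refl

  -- Strip n ≤ k leading abstractions λx₁…xₙ.u (n = k, or n < k and u not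
  -- an abstraction), then return u[x₁:=s₁,…,xₙ:=sₙ] sₙ₊₁ ⋯ sₖ.
  strip : ∀ {Γ Γ' as τ} → Term Γ' (as ⇒* τ) → MArgs [] Γ as → Sub [] Γ' Γ → Term Γ τ
  strip {as = []}    t []       θ = sub θ t
  strip {as = a ∷ as} t (s ∷ ss) θ with body? t
  ... | just u  = strip u ss (s ∷ₛ θ)
  ... | nothing = apply* (sub θ t) (s ∷ ss)

  -- Z⟨s₁,…,sₖ⟩γ  given γ(Z) = t and the already instantiated sᵢγ
  instMeta : ∀ {Γ as τ} → Term Γ (as ⇒* τ) → MArgs [] Γ as → Term Γ τ
  instMeta t ss = strip t ss var

  MSub : MCtx → List (Ty S) → Set
  MSub Δ Θ = ∀ {as τ} → Δ ∋ (as , τ) → Term Θ (as ⇒* τ)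

  wkN : ∀ {Θ} (Γ' : List (Ty S)) → Ren Θ (Γ' ++ Θ)
  wkN []       x = x
  wkN (a ∷ Γ') x = there (wkN Γ' x)

  injL : ∀ {Θ a} (Γ' : List (Ty S)) → Γ' ∋ a → (Γ' ++ Θ) ∋ a
  injL (_ ∷ Γ') here      = here
  injL (_ ∷ Γ') (there x) = there (injL Γ' x)

  -- application of γ to a meta-term whose free variables Γ' are the ones
  -- bound above it (the result lives in Γ' ++ Θ)
  mutual
    inst : ∀ {Δ Θ Γ' σ} → MSub Δ Θ → MTerm Δ Γ' σ → Term (Γ' ++ Θ) σ
    inst {Γ' = Γ'} γ (var x)     = var (injL Γ' x)
    inst γ (fun f)               = fun f
    inst γ (app s t)             = app (inst γ s) (inst γ t)
    inst γ (lam s)               = lam (inst γ s)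
    inst {Γ' = Γ'} γ (meta Z ss) = instMeta (ren (wkN Γ') (γ Z)) (instArgs γ ss)

    instArgs : ∀ {Δ Θ Γ' as} → MSub Δ Θ → MArgs Δ Γ' as → MArgs [] (Γ' ++ Θ) as
    instArgs γ []       = []
    instArgs γ (s ∷ ss) = inst γ s ∷ instArgs γ ss

  mutual
    data OccM {Δ as τ} (Z : Δ ∋ (as , τ)) : ∀ {Γ σ} → MTerm Δ Γ σ → Set where
      atZ  : ∀ {Γ} (ss : MArgs Δ Γ as) → OccM Z (meta Z ss)
      inZ  : ∀ {Γ bs ρ} {Z' : Δ ∋ (bs , ρ)} {ss : MArgs Δ Γ bs} → OccMArgs Z ss → OccM Z (meta Z' ss)
      appˡ : ∀ {Γ σ τ'} {s : MTerm Δ Γ (σ ⇒ τ')} {t} → OccM Z s → OccM Z (app s t)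
      appʳ : ∀ {Γ σ τ'} {s : MTerm Δ Γ (σ ⇒ τ')} {t} → OccM Z t → OccM Z (app s t)
      inλ  : ∀ {Γ σ τ'} {s : MTerm Δ (σ ∷ Γ) τ'} → OccM Z s → OccM Z (lam s)

    data OccMArgs {Δ as τ} (Z : Δ ∋ (as , τ)) : ∀ {Γ bs} → MArgs Δ Γ bs → Set where
      hd : ∀ {Γ b bs} {s : MTerm Δ Γ b} {ss : MArgs Δ Γ bs} → OccM Z s → OccMArgs Z (s ∷ ss)
      tl : ∀ {Γ b bs} {s : MTerm Δ Γ b} {ss : MArgs Δ Γ bs} → OccMArgs Z ss → OccMArgs Z (s ∷ ss)

  mutual
    data OccF (f : F) {Δ} : ∀ {Γ σ} → MTerm Δ Γ σ → Set where
      atf  : ∀ {Γ} → OccF f {Δ} {Γ} (fun f)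
      inZ  : ∀ {Γ bs ρ} {Z : Δ ∋ (bs , ρ)} {ss : MArgs Δ Γ bs} → OccFArgs f ss → OccF f (meta Z ss)
      appˡ : ∀ {Γ σ τ'} {s : MTerm Δ Γ (σ ⇒ τ')} {t} → OccF f s → OccF f (app s t)
      appʳ : ∀ {Γ σ τ'} {s : MTerm Δ Γ (σ ⇒ τ')} {t} → OccF f t → OccF f (app s t)
      inλ  : ∀ {Γ σ τ'} {s : MTerm Δ (σ ∷ Γ) τ'} → OccF f s → OccF f (lam s)

    data OccFArgs (f : F) {Δ} : ∀ {Γ bs} → MArgs Δ Γ bs → Set where
      hd : ∀ {Γ b bs} {s : MTerm Δ Γ b} {ss : MArgs Δ Γ bs} → OccF f s → OccFArgs f (s ∷ ss)
      tl : ∀ {Γ b bs} {s : MTerm Δ Γ b} {ss : MArgs Δ Γ bs} → OccFArgs f ss → OccFArgs f (s ∷ ss)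

  data Vars (Γ : List (Ty S)) : List (Ty S) → Set where
    []  : Vars Γ []
    _∷_ : ∀ {a as} → Γ ∋ a → Vars Γ as → Vars Γ (a ∷ as)

  varArgs : ∀ {Δ Γ as} → Vars Γ as → MArgs Δ Γ as
  varArgs []       = []
  varArgs (x ∷ xs) = var x ∷ varArgs xs

  positions : ∀ {Γ as} → Vars Γ as → List (Fin (length Γ))
  positions []       = []
  positions (x ∷ xs) = position x ∷ positions xs

  Distinct : ∀ {Γ as} → Vars Γ as → Set
  Distinct xs = Unique (positions xs)

  mutual
    data IsPattern {Δ} : ∀ {Γ σ} → MTerm Δ Γ σ → Set where
      pmeta  : ∀ {Γ as τ} (Z : Δ ∋ (as , τ)) (xs : Vars Γ as) → Distinct xs →
               IsPattern (meta Z (varArgs xs))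
      plam   : ∀ {Γ σ τ} {s : MTerm Δ (σ ∷ Γ) τ} → IsPattern s → IsPattern (lam s)
      pspine : ∀ {Γ σ} {t : MTerm Δ Γ σ} → IsSpine t → IsPattern t

    data IsSpine {Δ} : ∀ {Γ σ} → MTerm Δ Γ σ → Set where
      hvar : ∀ {Γ σ} (x : Γ ∋ σ) → IsSpine {Δ} (var x)
      hfun : ∀ {Γ} (f : F) → IsSpine {Δ} {Γ} (fun f)
      happ : ∀ {Γ σ τ} {s : MTerm Δ Γ (σ ⇒ τ)} {t} → IsSpine s → IsPattern t → IsSpine (app s t)

  data IsRuleLhs {Δ} : ∀ {Γ σ} → MTerm Δ Γ σ → Set where
    lfun : ∀ {Γ} (f : F) → IsRuleLhs {Δ} {Γ} (fun f)
    lapp : ∀ {Γ σ τ} {s : MTerm Δ Γ (σ ⇒ τ)} {t} → IsRuleLhs s → IsPattern t → IsRuleLhs (app s t)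

  record Rule : Set where
    field
      mctx   : MCtx
      rtype  : Ty S
      lhs    : MTerm mctx [] rtype
      rhs    : MTerm mctx [] rtype
      lhsPat : IsRuleLhs lhs
      fmv⊆   : ∀ {as τ} (Z : mctx ∋ (as , τ)) → OccM Z rhs → OccM Z lhs
  open Rule public

  module _ (R : Rule → Set) where

    data _⟶_ {Γ} : ∀ {σ} → Term Γ σ → Term Γ σ → Set where
      rule : (ρ : Rule) → R ρ → (δ : MSub (mctx ρ) Γ) →
             inst δ (lhs ρ) ⟶ inst δ (rhs ρ)
      appˡ : ∀ {σ τ} {s s' : Term Γ (σ ⇒ τ)} {t} → s ⟶ s' → app s t ⟶ app s' t
      appʳ : ∀ {σ τ} {s : Term Γ (σ ⇒ τ)} {t t'} → t ⟶ t' → app s t ⟶ app s t'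
      lamζ : ∀ {σ τ} {s s' : Term (σ ∷ Γ) τ} → _⟶_ {σ ∷ Γ} s s' → lam s ⟶ lam s'
      beta : ∀ {σ τ} (s : Term (σ ∷ Γ) τ) (t : Term Γ σ) → app (lam s) t ⟶ (s [ t ])

    InfiniteFrom : ∀ {Γ σ} → Term Γ σ → Set
    InfiniteFrom {Γ} {σ} t =
      Σ (ℕ → Term Γ σ) λ u → (u zero ≡ t) × (∀ i → u i ⟶ u (suc i))

    TerminatingOn : (∀ {Γ σ} → Term Γ σ → Set) → Set
    TerminatingOn P = ∀ {Γ σ} (t : Term Γ σ) → P t → ¬ InfiniteFrom t

    InRules : F → Set
    InRules f = Σ Rule λ ρ → R ρ × (OccF f (lhs ρ) ⊎ OccF f (rhs ρ))

  AllTerms : ∀ {Γ σ} → Term Γ σ → Set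
  AllTerms _ = ⊤

  OnlySymbols : (F → Set) → ∀ {Γ σ} → Term Γ σ → Set
  OnlySymbols P t = ∀ f → OccF f t → P f

-- Replace every function symbol of a term t that occurs in no rule by a
-- fresh variable of the same type.  This map commutes with rule steps
-- (it fixes all rule symbols) and with β-steps (it is a substitution),
-- and it sends no symbol to an abstraction, so instantiating a
-- meta-variable strips the same λs before and after.  Hence an infinite
-- reduction from t maps to one from a term over F_R.  Which symbols of t
-- are rule symbols need not be decidable, but the goal is a negation, so
-- the finitely many instances of excluded middle can be assumed.

module Submission where

open import Data.Nat using (ℕ)
open import Data.Nat.Properties using (eq?)
open import Data.List using (List; []; _∷_; _++_; map)
open import Data.List.Relation.Unary.All as All using (All; lookup)
open import Data.List.Relation.Unary.Any as Any using ()
open import Data.List.Membership.Propositional.Properties using (∈-++⁺ˡ; ∈-++⁺ʳ)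
open import Data.Product using (Σ; _×_; _,_; proj₁; proj₂)
open import Data.Sum using (inj₁; inj₂)
open import Data.Maybe using (nothing)
open import Data.Unit using (⊤; tt)
open import Data.Empty using (⊥)
open import Function.Bundles using (_⇔_; mk⇔; mk↣)
open import Function.Definitions using (Injective)
open import Relation.Binary.Definitions using (DecidableEquality)
open import Relation.Binary.PropositionalEquality
open import Relation.Nullary using (¬_; Dec; yes; no; contradiction)
open import Relation.Nullary.Decidable using (¬¬-excluded-middle)
open import Relation.Nullary.Negation using (¬¬-Monad)
open import Defs

¬¬-decide-all : {A : Set} (P : A → Set) (xs : List A) → ¬ ¬ All (λ x → Dec (P x)) xs
¬¬-decide-all P xs = All.sequenceM _ ¬¬-Monad (All.universal (λ _ → ¬¬-excluded-middle) xs)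

module GeneralisedSubstitution {S F : Set} (ty : F → Ty S) where

  open ≡-Reasoning

  private
    variable
      Γ Γ' Γ'' Γ₀ Γ₀' Θ Θ' : List (Ty S)
      a b σ τ : Ty S
      as : List (Ty S)
      f : F

  Tm : List (Ty S) → Ty S → Set
  Tm = Term ty

  infix  4 _≗ʳ_ _≈_
  infixr 9 _⊙_ _∘ʳ_ _ʳ∘_

  _≗ʳ_ : Ren ty Γ Γ' → Ren ty Γ Γ' → Set
  ρ ≗ʳ ρ' = ∀ {a} (x : _ ∋ a) → ρ x ≡ ρ' x

  extR-cong : {ρ ρ' : Ren ty Γ Γ'} → ρ ≗ʳ ρ' → extR ty {a = a} ρ ≗ʳ extR ty ρ'
  extR-cong e here      = refl
  extR-cong e (there x) = cong there (e x)

  ren-cong : {ρ ρ' : Ren ty Γ Γ'} → ρ ≗ʳ ρ' → (t : Tm Γ σ) → ren ty ρ t ≡ ren ty ρ' t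
  ren-cong e (var x)     = cong var (e x)
  ren-cong e (fun f)     = refl
  ren-cong e (app s t)   = cong₂ app (ren-cong e s) (ren-cong e t)
  ren-cong e (lam s)     = cong lam (ren-cong (extR-cong e) s)
  ren-cong e (meta () _)

  ren-∘ : (ρ₂ : Ren ty Γ' Γ'') (ρ₁ : Ren ty Γ Γ') (t : Tm Γ σ) →
          ren ty ρ₂ (ren ty ρ₁ t) ≡ ren ty (λ x → ρ₂ (ρ₁ x)) t
  ren-∘ ρ₂ ρ₁ (var x)     = refl
  ren-∘ ρ₂ ρ₁ (fun f)     = refl
  ren-∘ ρ₂ ρ₁ (app s t)   = cong₂ app (ren-∘ ρ₂ ρ₁ s) (ren-∘ ρ₂ ρ₁ t)
  ren-∘ ρ₂ ρ₁ (lam s)     =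
    cong lam (trans (ren-∘ (extR ty ρ₂) (extR ty ρ₁) s) (ren-cong (λ { here → refl ; (there x) → refl }) s))
  ren-∘ ρ₂ ρ₁ (meta () _)

  ren-id : (t : Tm Γ σ) → ren ty (λ x → x) t ≡ t
  ren-id (var x)     = refl
  ren-id (fun f)     = refl
  ren-id (app s t)   = cong₂ app (ren-id s) (ren-id t)
  ren-id (lam s)     = cong lam (trans (ren-cong (λ { here → refl ; (there x) → refl }) s) (ren-id s))
  ren-id (meta () _)

  record GSub (Γ Γ' : List (Ty S)) : Set where
    field
      onVar : ∀ {a} → Γ ∋ a → Tm Γ' a
      onFun : (f : F) → Tm Γ' (ty f)
  open GSub public

  extG : GSub Γ Γ' → GSub (a ∷ Γ) (a ∷ Γ')
  extG K .onVar here      = var here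
  extG K .onVar (there x) = ren ty there (K .onVar x)
  extG K .onFun f         = ren ty there (K .onFun f)

  gsub : GSub Γ Γ' → Tm Γ σ → Tm Γ' σ
  gsub K (var x)     = K .onVar x
  gsub K (fun f)     = K .onFun f
  gsub K (app s t)   = app (gsub K s) (gsub K t)
  gsub K (lam s)     = lam (gsub (extG K) s)
  gsub K (meta () _)

  gsubArgs : GSub Γ Γ' → MArgs ty [] Γ as → MArgs ty [] Γ' as
  gsubArgs K []       = []
  gsubArgs K (s ∷ ss) = gsub K s ∷ gsubArgs K ss

  _≈_ : GSub Γ Γ' → GSub Γ Γ' → Set
  K ≈ L = (∀ {a} (x : _ ∋ a) → K .onVar x ≡ L .onVar x) × (∀ f → K .onFun f ≡ L .onFun f)

  extG-cong : {K L : GSub Γ Γ'} → K ≈ L → extG {a = a} K ≈ extG L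
  extG-cong (v , g) = (λ { here → refl ; (there x) → cong (ren ty there) (v x) }) , λ f → cong (ren ty there) (g f)

  gsub-cong : {K L : GSub Γ Γ'} → K ≈ L → (t : Tm Γ σ) → gsub K t ≡ gsub L t
  gsub-cong e (var x)     = proj₁ e x
  gsub-cong e (fun f)     = proj₂ e f
  gsub-cong e (app s t)   = cong₂ app (gsub-cong e s) (gsub-cong e t)
  gsub-cong e (lam s)     = cong lam (gsub-cong (extG-cong e) s)
  gsub-cong e (meta () _)

  _∘ʳ_ : GSub Γ' Γ'' → Ren ty Γ Γ' → GSub Γ Γ''
  (K ∘ʳ ρ) .onVar x = K .onVar (ρ x)
  (K ∘ʳ ρ) .onFun   = K .onFun

  _ʳ∘_ : Ren ty Γ' Γ'' → GSub Γ Γ' → GSub Γ Γ''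
  (ρ ʳ∘ K) .onVar x = ren ty ρ (K .onVar x)
  (ρ ʳ∘ K) .onFun f = ren ty ρ (K .onFun f)

  gsub-ren : (K : GSub Γ' Γ'') (ρ : Ren ty Γ Γ') (t : Tm Γ σ) → gsub K (ren ty ρ t) ≡ gsub (K ∘ʳ ρ) t
  gsub-ren K ρ (var x)     = refl
  gsub-ren K ρ (fun f)     = refl
  gsub-ren K ρ (app s t)   = cong₂ app (gsub-ren K ρ s) (gsub-ren K ρ t)
  gsub-ren K ρ (lam s)     =
    cong lam (trans (gsub-ren (extG K) (extR ty ρ) s) (gsub-cong ((λ { here → refl ; (there x) → refl }) , λ f → refl) s))
  gsub-ren K ρ (meta () _)

  ren-extR-there : (ρ : Ren ty Γ Γ') (t : Tm Γ σ) →
                   ren ty (extR ty {a = a} ρ) (ren ty there t) ≡ ren ty there (ren ty ρ t)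
  ren-extR-there ρ t = trans (ren-∘ (extR ty ρ) there t) (sym (ren-∘ there ρ t))

  ren-gsub : (ρ : Ren ty Γ' Γ'') (K : GSub Γ Γ') (t : Tm Γ σ) → ren ty ρ (gsub K t) ≡ gsub (ρ ʳ∘ K) t
  ren-gsub ρ K (var x)     = refl
  ren-gsub ρ K (fun f)     = refl
  ren-gsub ρ K (app s t)   = cong₂ app (ren-gsub ρ K s) (ren-gsub ρ K t)
  ren-gsub ρ K (lam s)     =
    cong lam (trans (ren-gsub (extR ty ρ) (extG K) s)
                    (gsub-cong ( (λ { here → refl ; (there x) → ren-extR-there ρ (K .onVar x) })
                               , λ f → ren-extR-there ρ (K .onFun f)) s))
  ren-gsub ρ K (meta () _)

  _⊙_ : GSub Γ' Γ'' → GSub Γ Γ' → GSub Γ Γ''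
  (K ⊙ M) .onVar x = gsub K (M .onVar x)
  (K ⊙ M) .onFun f = gsub K (M .onFun f)

  gsub-extG-there : (K : GSub Γ Γ') (t : Tm Γ σ) → gsub (extG {a = a} K) (ren ty there t) ≡ ren ty there (gsub K t)
  gsub-extG-there K t = trans (gsub-ren (extG K) there t) (sym (ren-gsub there K t))

  extG-⊙ : (K : GSub Γ' Γ'') (M : GSub Γ Γ') → extG {a = a} K ⊙ extG M ≈ extG (K ⊙ M)
  extG-⊙ K M = (λ { here → refl ; (there x) → gsub-extG-there K (M .onVar x) }) , λ f → gsub-extG-there K (M .onFun f)

  gsub-⊙ : (K : GSub Γ' Γ'') (M : GSub Γ Γ') (t : Tm Γ σ) → gsub K (gsub M t) ≡ gsub (K ⊙ M) t
  gsub-⊙ K M (var x)     = refl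
  gsub-⊙ K M (fun f)     = refl
  gsub-⊙ K M (app s t)   = cong₂ app (gsub-⊙ K M s) (gsub-⊙ K M t)
  gsub-⊙ K M (lam s)     = cong lam (trans (gsub-⊙ (extG K) (extG M) s) (gsub-cong (extG-⊙ K M) s))
  gsub-⊙ K M (meta () _)

  fromSub : Sub ty [] Γ Γ' → GSub Γ Γ'
  fromSub θ .onVar = θ
  fromSub θ .onFun = fun

  gsub-id : (t : Tm Γ σ) → gsub (fromSub var) t ≡ t
  gsub-id (var x)     = refl
  gsub-id (fun f)     = refl
  gsub-id (app s t)   = cong₂ app (gsub-id s) (gsub-id t)
  gsub-id (lam s)     = cong lam (trans (gsub-cong ((λ { here → refl ; (there x) → refl }) , λ f → refl) s) (gsub-id s))
  gsub-id (meta () _)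

  sub-as-gsub : (θ : Sub ty [] Γ Γ') (t : Tm Γ σ) → sub ty θ t ≡ gsub (fromSub θ) t
  sub-as-gsub θ (var x)     = refl
  sub-as-gsub θ (fun f)     = refl
  sub-as-gsub θ (app s t)   = cong₂ app (sub-as-gsub θ s) (sub-as-gsub θ t)
  sub-as-gsub θ (lam s)     =
    cong lam (trans (sub-as-gsub (extS ty θ) s) (gsub-cong ((λ { here → refl ; (there x) → refl }) , λ f → refl) s))
  sub-as-gsub θ (meta () _)

  gsub-sub-square : {θ : Sub ty [] Γ₀ Γ} {M : GSub Γ₀ Γ₀'} {θ' : Sub ty [] Γ₀' Γ'} {L : GSub Γ Γ'} →
                    L ⊙ fromSub θ ≈ fromSub θ' ⊙ M →
                    (t : Tm Γ₀ σ) → gsub L (sub ty θ t) ≡ sub ty θ' (gsub M t)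
  gsub-sub-square {θ = θ} {M} {θ'} {L} sq t = begin
    gsub L (sub ty θ t)            ≡⟨ cong (gsub L) (sub-as-gsub θ t) ⟩
    gsub L (gsub (fromSub θ) t)    ≡⟨ gsub-⊙ L (fromSub θ) t ⟩
    gsub (L ⊙ fromSub θ) t         ≡⟨ gsub-cong sq t ⟩
    gsub (fromSub θ' ⊙ M) t        ≡⟨ gsub-⊙ (fromSub θ') M t ⟨
    gsub (fromSub θ') (gsub M t)   ≡⟨ sub-as-gsub θ' (gsub M t) ⟨
    sub ty θ' (gsub M t)           ∎

  square-∷ₛ : {θ : Sub ty [] Γ₀ Γ} {M : GSub Γ₀ Γ₀'} {θ' : Sub ty [] Γ₀' Γ'} {L : GSub Γ Γ'} (s : Tm Γ a) →
              L ⊙ fromSub θ ≈ fromSub θ' ⊙ M →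
              L ⊙ fromSub (_∷ₛ_ ty s θ) ≈ fromSub (_∷ₛ_ ty (gsub L s) θ') ⊙ extG M
  square-∷ₛ {M = M} s (v , g) =
    (λ { here → refl ; (there x) → trans (v x) (sym (gsub-ren _ there (M .onVar x))) }) ,
    λ f → trans (g f) (sym (gsub-ren _ there (M .onFun f)))

  square-id : (L : GSub Γ Γ') → L ⊙ fromSub var ≈ fromSub var ⊙ L
  square-id L = (λ x → sym (gsub-id (L .onVar x))) , λ f → sym (gsub-id (L .onFun f))

  gsub-[] : (K : GSub Γ Γ') (s : Tm (a ∷ Γ) σ) (t : Tm Γ a) →
            gsub K (_[_] ty s t) ≡ _[_] ty (gsub (extG K) s) (gsub K t)
  gsub-[] K s t = gsub-sub-square (square-∷ₛ t (square-id K)) s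

  NotLam : Tm Γ σ → Set
  NotLam (lam _) = ⊥
  NotLam _       = ⊤

  data LamView : Tm Γ σ → Set where
    isLam  : (u : Tm (a ∷ Γ) b) → LamView (lam u)
    notLam : (t : Tm Γ σ) → NotLam t → LamView t

  lamView : (t : Tm Γ σ) → LamView t
  lamView (var x)     = notLam _ tt
  lamView (fun f)     = notLam _ tt
  lamView (app s t)   = notLam _ tt
  lamView (lam u)     = isLam u
  lamView (meta () _)

  body?-NotLam : {ρ : Ty S} (t : Tm Γ ρ) → NotLam t → ∀ a b (e : ρ ≡ a ⇒ b) → body?′ ty t a b e ≡ nothing
  body?-NotLam (var x)     _ a b e = refl
  body?-NotLam (fun f)     _ a b e = refl
  body?-NotLam (app s t)   _ a b e = refl
  body?-NotLam (meta () _) _ a b e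

  strip-NotLam : (t : Tm Γ₀ (a ⇒ (as ⇒* τ))) {s : Tm Γ a} {ss : MArgs ty [] Γ as} {θ : Sub ty [] Γ₀ Γ} →
                 NotLam t → strip ty t (s ∷ ss) θ ≡ apply* ty (sub ty θ t) (s ∷ ss)
  strip-NotLam {a = a} {as} {τ} t ¬λ with body? ty t | body?-NotLam t ¬λ a (as ⇒* τ) refl
  ... | .nothing | refl = refl

  NotLamValued : GSub Γ Γ' → Set
  NotLamValued K = (∀ {a} (x : _ ∋ a) → NotLam (K .onVar x)) × (∀ f → NotLam (K .onFun f))

  ren-NotLam : (ρ : Ren ty Γ Γ') (t : Tm Γ σ) → NotLam t → NotLam (ren ty ρ t)
  ren-NotLam ρ (var x)     _ = tt
  ren-NotLam ρ (fun f)     _ = tt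
  ren-NotLam ρ (app s t)   _ = tt
  ren-NotLam ρ (meta () _) _

  extG-NotLamValued : {K : GSub Γ Γ'} → NotLamValued K → NotLamValued (extG {a = a} K)
  extG-NotLamValued {K = K} (v , g) =
    (λ { here → tt ; (there x) → ren-NotLam there (K .onVar x) (v x) }) , λ f → ren-NotLam there (K .onFun f) (g f)

  gsub-NotLam : {K : GSub Γ Γ'} → NotLamValued K → (t : Tm Γ σ) → NotLam t → NotLam (gsub K t)
  gsub-NotLam (v , g) (var x)     _ = v x
  gsub-NotLam (v , g) (fun f)     _ = g f
  gsub-NotLam (v , g) (app s t)   _ = tt
  gsub-NotLam (v , g) (meta () _) _

  gsub-apply* : (L : GSub Γ Γ') (t : Tm Γ (as ⇒* τ)) (ss : MArgs ty [] Γ as) →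
                gsub L (apply* ty t ss) ≡ apply* ty (gsub L t) (gsubArgs L ss)
  gsub-apply* L t []       = refl
  gsub-apply* L t (s ∷ ss) = gsub-apply* L (app t s) ss

  gsub-strip : {θ : Sub ty [] Γ₀ Γ} {M : GSub Γ₀ Γ₀'} {θ' : Sub ty [] Γ₀' Γ'} {L : GSub Γ Γ'} →
               NotLamValued M → L ⊙ fromSub θ ≈ fromSub θ' ⊙ M →
               (t : Tm Γ₀ (as ⇒* τ)) (ss : MArgs ty [] Γ as) →
               gsub L (strip ty t ss θ) ≡ strip ty (gsub M t) (gsubArgs L ss) θ'
  gsub-strip {as = []} _ sq t [] = gsub-sub-square sq t
  gsub-strip {as = _ ∷ _} {θ = θ} {M} {θ'} {L} nl sq t (s ∷ ss) with lamView t
  ... | isLam u = gsub-strip (extG-NotLamValued nl) (square-∷ₛ s sq) u ss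
  ... | notLam t ¬λ = begin
    gsub L (strip ty t (s ∷ ss) θ)                      ≡⟨ cong (gsub L) (strip-NotLam t ¬λ) ⟩
    gsub L (apply* ty (sub ty θ t) (s ∷ ss))            ≡⟨ gsub-apply* L (sub ty θ t) (s ∷ ss) ⟩
    apply* ty (gsub L (sub ty θ t)) (gsubArgs L (s ∷ ss)) ≡⟨ cong (λ u → apply* ty u (gsubArgs L (s ∷ ss))) (gsub-sub-square sq t) ⟩
    apply* ty (sub ty θ' (gsub M t)) (gsubArgs L (s ∷ ss)) ≡⟨ strip-NotLam (gsub M t) (gsub-NotLam nl t ¬λ) ⟨
    strip ty (gsub M t) (gsubArgs L (s ∷ ss)) θ'        ∎

  liftG : (G : List (Ty S)) → GSub Θ Θ' → GSub (G ++ Θ) (G ++ Θ')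
  liftG []      K = K
  liftG (_ ∷ G) K = extG (liftG G K)

  liftG-NotLamValued : (G : List (Ty S)) {K : GSub Θ Θ'} → NotLamValued K → NotLamValued (liftG G K)
  liftG-NotLamValued []      nl = nl
  liftG-NotLamValued (_ ∷ G) nl = extG-NotLamValued (liftG-NotLamValued G nl)

  liftG-injL : (G : List (Ty S)) (K : GSub Θ Θ') (x : G ∋ a) → liftG G K .onVar (injL ty G x) ≡ var (injL ty G x)
  liftG-injL (_ ∷ G) K here      = refl
  liftG-injL (_ ∷ G) K (there x) = cong (ren ty there) (liftG-injL G K x)

  liftG-fixes : (G : List (Ty S)) (K : GSub Θ Θ') → K .onFun f ≡ fun f → liftG G K .onFun f ≡ fun f
  liftG-fixes []      K e = e
  liftG-fixes (_ ∷ G) K e = cong (ren ty there) (liftG-fixes G K e)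

  liftG-wkN : (G : List (Ty S)) (K : GSub Θ Θ') → liftG G K ∘ʳ wkN ty G ≈ wkN ty G ʳ∘ K
  liftG-wkN []      K = (λ x → sym (ren-id (K .onVar x))) , λ f → sym (ren-id (K .onFun f))
  liftG-wkN (_ ∷ G) K =
    (λ x → trans (cong (ren ty there) (proj₁ (liftG-wkN G K) x)) (ren-∘ there (wkN ty G) (K .onVar x))) ,
    λ f → trans (cong (ren ty there) (proj₂ (liftG-wkN G K) f)) (ren-∘ there (wkN ty G) (K .onFun f))

  gsub-wkN : (G : List (Ty S)) (K : GSub Θ Θ') (u : Tm Θ σ) →
             gsub (liftG G K) (ren ty (wkN ty G) u) ≡ ren ty (wkN ty G) (gsub K u)
  gsub-wkN G K u = trans (gsub-ren _ _ u) (trans (gsub-cong (liftG-wkN G K) u) (sym (ren-gsub _ K u)))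

  mutual
    gsub-inst : ∀ {Δ G} {K : GSub Θ Θ'} (γ : MSub ty Δ Θ) → NotLamValued K →
                (m : MTerm ty Δ G σ) → (∀ f → OccF ty f m → K .onFun f ≡ fun f) →
                gsub (liftG G K) (inst ty γ m) ≡ inst ty (λ Z → gsub K (γ Z)) m
    gsub-inst {G = G} {K} γ nl (var x)   fix = liftG-injL G K x
    gsub-inst {G = G} {K} γ nl (fun f)   fix = liftG-fixes G K (fix f atf)
    gsub-inst γ nl (app s t) fix =
      cong₂ app (gsub-inst γ nl s (λ f o → fix f (appˡ o))) (gsub-inst γ nl t (λ f o → fix f (appʳ o)))
    gsub-inst γ nl (lam s)   fix = cong lam (gsub-inst γ nl s (λ f o → fix f (inλ o)))
    gsub-inst {G = G} {K} γ nl (meta Z ss) fix = begin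
      gsub L (strip ty (ren ty (wkN ty G) (γ Z)) (instArgs ty γ ss) var)
        ≡⟨ gsub-strip (liftG-NotLamValued G nl) (square-id L) (ren ty (wkN ty G) (γ Z)) (instArgs ty γ ss) ⟩
      strip ty (gsub L (ren ty (wkN ty G) (γ Z))) (gsubArgs L (instArgs ty γ ss)) var
        ≡⟨ cong₂ (λ u us → strip ty u us var) (gsub-wkN G K (γ Z)) (gsub-instArgs γ nl ss (λ f o → fix f (inZ o))) ⟩
      strip ty (ren ty (wkN ty G) (gsub K (γ Z))) (instArgs ty (λ Z → gsub K (γ Z)) ss) var ∎
      where L = liftG G K

    gsub-instArgs : ∀ {Δ G} {K : GSub Θ Θ'} (γ : MSub ty Δ Θ) → NotLamValued K →
                    (ss : MArgs ty Δ G as) → (∀ f → OccFArgs ty f ss → K .onFun f ≡ fun f) →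
                    gsubArgs (liftG G K) (instArgs ty γ ss) ≡ instArgs ty (λ Z → gsub K (γ Z)) ss
    gsub-instArgs γ nl []       fix = refl
    gsub-instArgs γ nl (s ∷ ss) fix =
      cong₂ _∷_ (gsub-inst γ nl s (λ f o → fix f (hd o))) (gsub-instArgs γ nl ss (λ f o → fix f (tl o)))

  OccF-ren : (ρ : Ren ty Γ Γ') (t : Tm Γ σ) → OccF ty f (ren ty ρ t) → OccF ty f t
  OccF-ren ρ (fun g)     atf      = atf
  OccF-ren ρ (app s t)   (appˡ o) = appˡ (OccF-ren ρ s o)
  OccF-ren ρ (app s t)   (appʳ o) = appʳ (OccF-ren ρ t o)
  OccF-ren ρ (lam s)     (inλ o)  = inλ (OccF-ren (extR ty ρ) s o)
  OccF-ren ρ (meta () _) _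

  OccF-gsub : (K : GSub Γ Γ') (t : Tm Γ σ) → (∀ {a} (x : Γ ∋ a) → ¬ OccF ty f (K .onVar x)) →
              OccF ty f (gsub K t) → Σ F λ g → OccF ty g t × OccF ty f (K .onFun g)
  OccF-gsub K (var x)   noVar o = contradiction o (noVar x)
  OccF-gsub K (fun g)   noVar o = g , atf , o
  OccF-gsub K (app s t) noVar (appˡ o) with OccF-gsub K s noVar o
  ... | g , og , o' = g , appˡ og , o'
  OccF-gsub K (app s t) noVar (appʳ o) with OccF-gsub K t noVar o
  ... | g , og , o' = g , appʳ og , o'
  OccF-gsub K (lam s)   noVar (inλ o) with OccF-gsub (extG K) s noVar' o
    where
    noVar' : ∀ {a} (x : _ ∋ a) → ¬ OccF ty _ (extG K .onVar x)
    noVar' here      ()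
    noVar' (there x) o = noVar x (OccF-ren there (K .onVar x) o)
  ... | g , og , o' = g , inλ og , OccF-ren there (K .onFun g) o'
  OccF-gsub K (meta () _) noVar o

module Rewriting {S F : Set} (ty : F → Ty S) (R : Rule ty → Set) where

  open GeneralisedSubstitution ty

  private
    variable
      Γ Γ' : List (Ty S)
      σ : Ty S

  FixesRuleSymbols : GSub Γ Γ' → Set
  FixesRuleSymbols K = ∀ f → InRules ty R f → K .onFun f ≡ fun f

  gsub-⟶ : {K : GSub Γ Γ'} → NotLamValued K → FixesRuleSymbols K →
           {u u' : Tm Γ σ} → _⟶_ ty R u u' → _⟶_ ty R (gsub K u) (gsub K u')
  gsub-⟶ {K = K} nl fix (rule ρ r δ) =
    subst₂ (_⟶_ ty R)
      (sym (gsub-inst δ nl (lhs ρ) (λ f o → fix f (ρ , r , inj₁ o))))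
      (sym (gsub-inst δ nl (rhs ρ) (λ f o → fix f (ρ , r , inj₂ o))))
      (rule ρ r (λ Z → gsub K (δ Z)))
  gsub-⟶ nl fix (appˡ p)   = appˡ (gsub-⟶ nl fix p)
  gsub-⟶ nl fix (appʳ p)   = appʳ (gsub-⟶ nl fix p)
  gsub-⟶ nl fix (lamζ p)   = lamζ (gsub-⟶ (extG-NotLamValued nl) (λ f i → cong (ren ty there) (fix f i)) p)
  gsub-⟶ {K = K} nl fix (beta s t) = subst (_⟶_ ty R _) (sym (gsub-[] K s t)) (beta _ _)

  gsub-InfiniteFrom : {K : GSub Γ Γ'} → NotLamValued K → FixesRuleSymbols K →
                      {t : Tm Γ σ} → InfiniteFrom ty R t → InfiniteFrom ty R (gsub K t)
  gsub-InfiniteFrom {K = K} nl fix (u , u₀ , steps) =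
    (λ i → gsub K (u i)) , cong (gsub K) u₀ , λ i → gsub-⟶ nl fix (steps i)

module SymbolAbstraction {S F : Set} (ty : F → Ty S) (_≟_ : DecidableEquality F) (P : F → Set) where

  open GeneralisedSubstitution ty
  open import Data.List.Membership.DecPropositional _≟_ using (_∈_; _∈?_)

  private
    variable
      Γ : List (Ty S)
      σ : Ty S
      f g : F
      xs : List F

  symbols : Tm Γ σ → List F
  symbols (var x)     = []
  symbols (fun f)     = f ∷ []
  symbols (app s t)   = symbols s ++ symbols t
  symbols (lam s)     = symbols s
  symbols (meta () _)

  OccF⇒∈symbols : (t : Tm Γ σ) → OccF ty f t → f ∈ symbols t
  OccF⇒∈symbols (fun f)   atf      = Any.here refl
  OccF⇒∈symbols (app s t) (appˡ o) = ∈-++⁺ˡ (OccF⇒∈symbols s o)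
  OccF⇒∈symbols (app s t) (appʳ o) = ∈-++⁺ʳ (symbols s) (OccF⇒∈symbols t o)
  OccF⇒∈symbols (lam s)   (inλ o)  = OccF⇒∈symbols s o
  OccF⇒∈symbols (meta () _) _

  ∈⇒∋ : f ∈ xs → map ty xs ∋ ty f
  ∈⇒∋ (Any.here refl) = here
  ∈⇒∋ (Any.there p)   = there (∈⇒∋ p)

  abstractFun : ∀ Γ xs → All (λ f → Dec (P f)) xs → (f : F) → Tm (Γ ++ map ty xs) (ty f)
  abstractFun Γ xs d f with f ∈? xs
  ... | no _ = fun f
  ... | yes f∈ with lookup d f∈
  ...   | yes _ = fun f
  ...   | no _  = var (wkN ty Γ (∈⇒∋ f∈))

  abstractFun-NotLam : ∀ Γ xs d f → NotLam (abstractFun Γ xs d f)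
  abstractFun-NotLam Γ xs d f with f ∈? xs
  ... | no _ = tt
  ... | yes f∈ with lookup d f∈
  ...   | yes _ = tt
  ...   | no _  = tt

  abstractFun-fixes : ∀ Γ xs d f → P f → abstractFun Γ xs d f ≡ fun f
  abstractFun-fixes Γ xs d f pf with f ∈? xs
  ... | no _ = refl
  ... | yes f∈ with lookup d f∈
  ...   | yes _  = refl
  ...   | no ¬pf = contradiction pf ¬pf

  abstractFun-OccF : ∀ Γ xs d f → f ∈ xs → OccF ty g (abstractFun Γ xs d f) → P g
  abstractFun-OccF Γ xs d f f∈ o with f ∈? xs
  ... | no f∉ = contradiction f∈ f∉
  ... | yes f∈′ with lookup d f∈′ | o
  ...   | yes pf | atf = pf

  abstraction : ∀ Γ xs → All (λ f → Dec (P f)) xs → GSub Γ (Γ ++ map ty xs)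
  abstraction Γ xs d .onVar x = var (injL ty Γ x)
  abstraction Γ xs d .onFun   = abstractFun Γ xs d

  abstraction-NotLamValued : ∀ Γ xs d → NotLamValued (abstraction Γ xs d)
  abstraction-NotLamValued Γ xs d = (λ x → tt) , abstractFun-NotLam Γ xs d

  abstraction-only : ∀ Γ xs d (t : Tm Γ σ) → (∀ f → OccF ty f t → f ∈ xs) →
                     OnlySymbols ty P (gsub (abstraction Γ xs d) t)
  abstraction-only Γ xs d t ⊆xs g o with OccF-gsub (abstraction Γ xs d) t (λ x ()) o
  ... | f , of , og = abstractFun-OccF Γ xs d f (⊆xs f of) og

module _ {S F : Set} (ty : F → Ty S) (_≟_ : DecidableEquality F) (R : Rule ty → Set) where

  open GeneralisedSubstitution ty
  open Rewriting ty R
  open SymbolAbstraction ty _≟_ (InRules ty R)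

  terminating-on-rule-symbols⇒terminating :
    TerminatingOn ty R (OnlySymbols ty (InRules ty R)) → TerminatingOn ty R (AllTerms ty)
  terminating-on-rule-symbols⇒terminating term {Γ} t _ inf =
    ¬¬-decide-all (InRules ty R) (symbols t) λ d →
      term (gsub (abstraction Γ (symbols t) d) t)
           (abstraction-only Γ (symbols t) d t (λ f → OccF⇒∈symbols t))
           (gsub-InfiniteFrom (abstraction-NotLamValued Γ (symbols t) d)
                              (λ f → abstractFun-fixes Γ (symbols t) d f) inf)

theorem9 : {S F : Set} (ty : F → Ty S) →
    Σ (F → ℕ) (λ c → Injective _≡_ _≡_ c) →
    (R : Rule ty → Set) →
    TerminatingOn ty R (AllTerms ty) ⇔ TerminatingOn ty R (OnlySymbols ty (InRules ty R))
theorem9 ty (c , c-injective) R =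
  mk⇔ (λ term {_} {_} t _ → term t tt)
      (terminating-on-rule-symbols⇒terminating ty (eq? (mk↣ c-injective)) R)
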